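{- Let $\mathcal{X}$ be a finite co-tree and $n$ a positive integer. Then $\mathcal{X}\in\mathcal{T}_{n+1}$ if and only if there are $m,k\in\omega$ and points $x_0,\dots,x_m,y_0,\dots,y_k$ of $\mathcal{X}$ such that $x_0$ is the greatest element, $x_0>x_1>\dots>x_m$, $X=\{x_0,\dots,x_m\}\cup{\downarrow}y_0\cup\dots\cup{\downarrow}y_k$ where the sets ${\downarrow}y_i$ are pairwise disjoint and disjoint from $\{x_0,\dots,x_m\}$, $y_0,\dots,y_k$ are exactly the immediate predecessors of $x_m$, and ${\downarrow}y_i\in\mathcal{T}_n$ for all $i\le k$.
   Context: A co-tree is a poset with a greatest element in which every principal upset is a chain. ${\downarrow}y=\{z:z\le y\}$, viewed as a subposet (itself a co-tree). For $n\ge1$ the $n$-comb $\mathfrak{C}_n$ is the poset on $\{c_1,\dots,c_n,c_1',\dots,c_n'\}$ with order generated by $c_1<\dots<c_n$ and $c_i'<c_i$. $\mathcal{T}_n$ is the set of finite co-trees (up to isomorphism) into which $\mathfrak{C}_n$ does not order-embed (i.e., which have no subposet isomorphic to $\mathfrak{C}_n$). -}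

module Defs where

open import Data.Bool using (Bool; T)
open import Data.Nat as ℕ using (ℕ; suc)
open import Data.Fin using (Fin; toℕ)
open import Data.Sum using (_⊎_; inj₁; inj₂)
open import Data.Product using (Σ; _×_; _,_; proj₁; proj₂; ∃)
open import Data.List using (List)
open import Data.List.Membership.Propositional using (_∈_)
open import Data.Empty using (⊥)
open import Relation.Nullary using (¬_)
open import Relation.Binary.PropositionalEquality using (_≡_; _≢_; cong)
open import Function.Bundles using (_⇔_)

-- A poset whose order is given by a Boolean-valued relation (so that
-- proofs of x ≤ y are unique; subposets then have well-behaved carriers).
record Poset : Set₁ where
  field
    Carrier : Set
    _≤ᵇ_    : Carrier → Carrier → Bool
  _≤_ : Carrier → Carrier → Set
  x ≤ y = T (x ≤ᵇ y)
  field
    refl    : ∀ x → x ≤ x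
    antisym : ∀ {x y} → x ≤ y → y ≤ x → x ≡ y
    trans   : ∀ {x y z} → x ≤ y → y ≤ z → x ≤ z

  _<_ : Carrier → Carrier → Set
  x < y = x ≤ y × x ≢ y

  ImmPred : Carrier → Carrier → Set
  ImmPred x y = x < y × (∀ u → x ≤ u → u ≤ y → u ≡ x ⊎ u ≡ y)

open Poset public using (Carrier)

Finite : Poset → Set
Finite P = Σ (List (Carrier P)) λ xs → ∀ x → x ∈ xs

IsCoTree : Poset → Set
IsCoTree P = (Σ (Carrier P) λ t → ∀ x → x ≤ t)
           × (∀ x a b → x ≤ a → x ≤ b → a ≤ b ⊎ b ≤ a)
  where open Poset P hiding (Carrier)

-- The n-comb: c i = inj₁ i, c' i = inj₂ i (i < n, zero-based).
-- Order generated by c₁ < … < cₙ and c'ᵢ < cᵢ: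
--   cᵢ ≤ cⱼ  iff i ≤ j ;  c'ᵢ ≤ c'ⱼ iff i = j ;  c'ᵢ ≤ cⱼ iff i ≤ j ;  cᵢ ≰ c'ⱼ.
CombLe : (n : ℕ) → Fin n ⊎ Fin n → Fin n ⊎ Fin n → Set
CombLe n (inj₁ i) (inj₁ j) = toℕ i ℕ.≤ toℕ j
CombLe n (inj₂ i) (inj₂ j) = i ≡ j
CombLe n (inj₂ i) (inj₁ j) = toℕ i ℕ.≤ toℕ j
CombLe n (inj₁ i) (inj₂ j) = ⊥

CombEmbeds : ℕ → Poset → Set
CombEmbeds n P = Σ (Fin n ⊎ Fin n → Carrier P) λ f →
  ∀ a b → CombLe n a b ⇔ Poset._≤_ P (f a) (f b)

InT : ℕ → Poset → Set
InT n P = IsCoTree P × Finite P × ¬ CombEmbeds n P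

Down : (P : Poset) → Carrier P → Poset
Down P y = record
  { Carrier = Σ (Carrier P) λ z → z ≤ y
  ; _≤ᵇ_    = λ a b → proj₁ a ≤ᵇ proj₁ b
  ; refl    = λ a → refl (proj₁ a)
  ; antisym = λ {a} {b} p q → lemma a b (antisym p q)
  ; trans   = trans
  }
  where
    open Poset P hiding (Carrier)
    T-irr : ∀ {b} (p q : T b) → p ≡ q
    T-irr {Bool.true} _ _ = _≡_.refl
    lemma : ∀ (a b : Σ (Carrier P) λ z → z ≤ y) → proj₁ a ≡ proj₁ b → a ≡ b
    lemma (z , p) (.z , q) _≡_.refl = cong (z ,_) (T-irr p q)

{-# OPTIONS --safe #-}

-- Walking down from the greatest element while the current point has exactly one
-- immediate predecessor yields the chain x₀ > … > x_m; every other point lies below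
-- an immediate predecessor y_j of x_m, and in a co-tree the sets ↓y_j are disjoint.
-- Each y_j has a sibling y′ (x_m does not have exactly one immediate predecessor), so
-- an (n+1)-comb in ↓y_j extends to an (n+2)-comb in X: the new top of the spine goes
-- to x_m and the new top tooth to y′. Conversely, in an (n+2)-comb the second-highest
-- spine point is incomparable with the top tooth, whereas every x_i is comparable with
-- every point; so that spine point lies in some ↓y_j, and the (n+1)-comb below it too.

module Submission where

open import Defs
open import Data.Bool.Properties using (T?; T-irrelevant)
open import Data.Empty using (⊥; ⊥-elim)
open import Data.Fin using (Fin; zero; suc; fromℕ; inject₁; toℕ)
open import Data.Fin.Induction using (spo-wellFounded)
open import Data.Fin.Properties using (toℕ-fromℕ; toℕ-inject₁; inject₁ℕ<; ≤fromℕ; fromℕ≢inject₁; inject₁-injective)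
open import Data.Fin.Relation.Unary.Top using (view; ‵fromℕ; ‵inject₁)
open import Data.List using (List; []; _∷_; length; lookup; filter; deduplicate)
open import Data.List.Membership.Propositional using (_∈_; lose)
open import Data.List.Membership.Propositional.Properties using (∈-filter⁺; ∈-filter⁻; ∈-deduplicate⁺; ∈-lookup)
open import Data.List.Relation.Unary.All as All using (_∷_)
open import Data.List.Relation.Unary.AllPairs using (_∷_)
open import Data.List.Relation.Unary.Any as Any using (here; there; any?)
open import Data.List.Relation.Unary.Any.Properties using (lookup-index; ¬Any[])
open import Data.List.Relation.Unary.Unique.Propositional using (Unique)
open import Data.Nat using (ℕ; suc)
import Data.Nat as ℕ
import Data.Nat.Properties as ℕ
open import Data.Product using (Σ; _×_; ∃; _,_; proj₁; proj₂)
open import Data.Sum using (_⊎_; inj₁; inj₂; [_,_]′)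
import Data.Sum as Sum
import Data.Vec.Functional as Vector
open import Function using (_∘_; flip)
open import Function.Bundles using (_⇔_; mk⇔; Equivalence)
import Function.Properties.Equivalence as ⇔
open import Induction.WellFounded using (WellFounded; WfRec; module Subrelation; module All)
open import Level using (Level)
open import Relation.Binary using (Rel; IsPartialOrder; IsStrictPartialOrder; DecidableEquality; Decidable)
import Relation.Binary.Construct.Flip.EqAndOrd as Flip
import Relation.Binary.Construct.NonStrictToStrict as ToStrict
import Relation.Binary.Construct.On as On
open import Relation.Binary.PropositionalEquality using (_≡_; _≢_; refl; sym; cong; subst; subst₂; isEquivalence)
open import Relation.Nullary using (¬_; yes; no; ¬?; _×-dec_)
open import Relation.Nullary.Decidable using (map′)

open Equivalence using (to; from)

private
  variable
    ℓ ℓ′ : Level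
    A B : Set ℓ
    n : ℕ

both : A → B → A ⇔ B
both a b = mk⇔ (λ _ → b) (λ _ → a)

neither : ¬ A → ¬ B → A ⇔ B
neither ¬a ¬b = mk⇔ (⊥-elim ∘ ¬a) (⊥-elim ∘ ¬b)

∈⇔∃lookup : ∀ {a : A} {l} → a ∈ l ⇔ ∃ λ j → a ≡ lookup l j
∈⇔∃lookup = mk⇔ (λ a∈l → Any.index a∈l , lookup-index a∈l) (λ { (j , refl) → ∈-lookup j })

lookup-injective : ∀ {l : List A} → Unique l → ∀ {i j} → lookup l i ≡ lookup l j → i ≡ j
lookup-injective (_ ∷ _)      {zero}  {zero}  _ = refl
lookup-injective (a∉l ∷ _)    {zero}  {suc j} e = ⊥-elim (All.lookup a∉l (∈-lookup j) e)
lookup-injective (a∉l ∷ _)    {suc i} {zero}  e = ⊥-elim (All.lookup a∉l (∈-lookup i) (sym e))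
lookup-injective (_ ∷ unique) {suc i} {suc j} e = cong suc (lookup-injective unique e)

singleton⊎siblings : {P : A → Set ℓ} {l : List A} → (∀ a → a ∈ l ⇔ P a) → Unique l →
                     (∃ λ a → P a × ∀ b → P b → b ≡ a) ⊎ (∀ a → P a → ∃ λ b → P b × b ≢ a)
singleton⊎siblings {l = []} mem _ = inj₂ λ a pa → ⊥-elim (¬Any[] (from (mem a) pa))
singleton⊎siblings {l = a ∷ []} mem _ =
  inj₁ (a , to (mem a) (here refl) , λ b pb → only (from (mem b) pb))
  where only : ∀ {b} → b ∈ a ∷ [] → b ≡ a
        only (here b≡a) = b≡a
singleton⊎siblings {l = a ∷ b ∷ l} mem (a∉ ∷ _) = inj₂ λ c pc → sibling (from (mem c) pc)
  where sibling : ∀ {c} → c ∈ a ∷ b ∷ l → ∃ λ d → _ × d ≢ c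
        sibling (here refl) = b , to (mem b) (there (here refl)) , All.head a∉ ∘ sym
        sibling (there c∈) = a , to (mem a) (here refl) , All.lookup a∉ c∈

finite⇒wellFounded : {_≈_ : Rel A ℓ} {_⊏_ : Rel A ℓ′} (xs : List A) → (∀ a → a ∈ xs) →
                     IsStrictPartialOrder _≈_ _⊏_ → WellFounded _⊏_
finite⇒wellFounded {_⊏_ = _⊏_} xs xs∈ spo =
  Subrelation.wellFounded ⊏⇒⊏-at-index
    (On.wellFounded index (spo-wellFounded (On.isStrictPartialOrder (lookup xs) spo)))
  where
    index : _ → Fin (length xs)
    index a = Any.index (xs∈ a)
    ⊏⇒⊏-at-index : ∀ {a b} → a ⊏ b → lookup xs (index a) ⊏ lookup xs (index b)
    ⊏⇒⊏-at-index {a} {b} = subst₂ _⊏_ (lookup-index (xs∈ a)) (lookup-index (xs∈ b))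

Comb : ℕ → Set
Comb n = Fin n ⊎ Fin n

lift : Comb n → Comb (suc n)
lift = Sum.map inject₁ inject₁

spineTop toothTop : Comb (suc n)
spineTop = inj₁ (fromℕ _)
toothTop = inj₂ (fromℕ _)

data CombView : Comb (suc n) → Set where
  ‵lift     : (a : Comb n) → CombView (lift a)
  ‵spineTop : CombView {n} spineTop
  ‵toothTop : CombView {n} toothTop

combView : (a : Comb (suc n)) → CombView a
combView (inj₁ i) with view i
... | ‵fromℕ     = ‵spineTop
... | ‵inject₁ j = ‵lift (inj₁ j)
combView (inj₂ i) with view i
... | ‵fromℕ     = ‵toothTop
... | ‵inject₁ j = ‵lift (inj₂ j)

lift-≤⇔ : (a b : Comb n) → CombLe (suc n) (lift a) (lift b) ⇔ CombLe n a b
lift-≤⇔ (inj₁ i) (inj₁ j) rewrite toℕ-inject₁ i | toℕ-inject₁ j = ⇔.refl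
lift-≤⇔ (inj₂ i) (inj₁ j) rewrite toℕ-inject₁ i | toℕ-inject₁ j = ⇔.refl
lift-≤⇔ (inj₁ i) (inj₂ j) = ⇔.refl
lift-≤⇔ (inj₂ i) (inj₂ j) = mk⇔ inject₁-injective (cong inject₁)

≤-spineTop : (a : Comb (suc n)) → CombLe (suc n) a spineTop
≤-spineTop (inj₁ i) = ≤fromℕ i
≤-spineTop (inj₂ i) = ≤fromℕ i

fromℕ≰inject₁ : (j : Fin n) → ¬ toℕ (fromℕ n) ℕ.≤ toℕ (inject₁ j)
fromℕ≰inject₁ {n} j n≤j = ℕ.<⇒≱ (inject₁ℕ< j) (subst (ℕ._≤ toℕ (inject₁ j)) (toℕ-fromℕ n) n≤j)

lift-≰-toothTop : (a : Comb n) → ¬ CombLe (suc n) (lift a) toothTop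
lift-≰-toothTop (inj₁ i) ()
lift-≰-toothTop (inj₂ i) = fromℕ≢inject₁ ∘ sym

spineTop-≰-lift : (a : Comb n) → ¬ CombLe (suc n) spineTop (lift a)
spineTop-≰-lift (inj₁ j) = fromℕ≰inject₁ j
spineTop-≰-lift (inj₂ j) ()

toothTop-≰-lift : (a : Comb n) → ¬ CombLe (suc n) toothTop (lift a)
toothTop-≰-lift (inj₁ j) = fromℕ≰inject₁ j
toothTop-≰-lift (inj₂ j) = fromℕ≢inject₁

module PosetProperties (P : Poset) where
  open Poset P hiding (Carrier) renaming (refl to ≤-refl; trans to ≤-trans; antisym to ≤-antisym)
  private
    C = Carrier P

  ≤-isPartialOrder : IsPartialOrder _≡_ _≤_
  ≤-isPartialOrder = record
    { isPreorder = record
      { isEquivalence = isEquivalence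
      ; reflexive     = λ { refl → ≤-refl _ }
      ; trans         = ≤-trans
      }
    ; antisym = ≤-antisym
    }

  <-isStrictPartialOrder : IsStrictPartialOrder _≡_ _<_
  <-isStrictPartialOrder = ToStrict.<-isStrictPartialOrder _≡_ _≤_ ≤-isPartialOrder

  <⇒≱ : ∀ {a b} → a < b → ¬ b ≤ a
  <⇒≱ (a≤b , a≢b) b≤a = a≢b (≤-antisym a≤b b≤a)

  immPred-≤⇒≡ : ∀ {a b t} → ImmPred a t → ImmPred b t → a ≤ b → a ≡ b
  immPred-≤⇒≡ (_ , a-cover) ((b≤t , b≢t) , _) a≤b with a-cover _ a≤b b≤t
  ... | inj₁ b≡a = sym b≡a
  ... | inj₂ b≡t = ⊥-elim (b≢t b≡t)

  descending⇒last≤ : ∀ {m} (x : Fin (suc m) → C) → (∀ i → x (suc i) < x (inject₁ i)) →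
                     ∀ i → x (fromℕ m) ≤ x i
  descending⇒last≤ {ℕ.zero} x _    zero    = ≤-refl _
  descending⇒last≤ {suc m}  x desc zero    =
    ≤-trans (descending⇒last≤ (x ∘ suc) (desc ∘ suc) zero) (proj₁ (desc zero))
  descending⇒last≤ {suc m}  x desc (suc i) = descending⇒last≤ (x ∘ suc) (desc ∘ suc) i

  restrict-comb : CombEmbeds (suc n) P → CombEmbeds n P
  restrict-comb (f , f-emb) = f ∘ lift , λ a b → ⇔.trans (⇔.sym (lift-≤⇔ a b)) (f-emb (lift a) (lift b))

  comb-below : ∀ {y} (e : CombEmbeds (suc n) P) → proj₁ e spineTop ≤ y → CombEmbeds (suc n) (Down P y)
  comb-below (f , f-emb) f-spineTop≤y =
    (λ a → f a , ≤-trans (to (f-emb a spineTop) (≤-spineTop a)) f-spineTop≤y) , f-emb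

  extend-comb : ∀ {y y′ t} → y ≤ t → y′ ≤ t → (∀ z → z ≤ y → z ≤ y′ → ⊥) →
                CombEmbeds n (Down P y) → CombEmbeds (suc n) P
  extend-comb {n} {y} {y′} {t} y≤t y′≤t disjoint (f , f-emb) =
    (λ a → gᵛ (combView a)) , λ a b → gᵛ-emb (combView a) (combView b)
    where
      gᵛ : ∀ {a} → CombView a → C
      gᵛ (‵lift a) = proj₁ (f a)
      gᵛ ‵spineTop = t
      gᵛ ‵toothTop = y′

      f≤y : ∀ a → proj₁ (f a) ≤ y
      f≤y a = proj₂ (f a)

      t≰y : ¬ t ≤ y
      t≰y t≤y = disjoint y′ (≤-trans y′≤t t≤y) (≤-refl y′)

      t≰y′ : ¬ t ≤ y′
      t≰y′ t≤y′ = disjoint y (≤-refl y) (≤-trans y≤t t≤y′)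

      gᵛ-emb : ∀ {a b} (va : CombView a) (vb : CombView b) → CombLe (suc n) a b ⇔ gᵛ va ≤ gᵛ vb
      gᵛ-emb (‵lift a) (‵lift b) = ⇔.trans (lift-≤⇔ a b) (f-emb a b)
      gᵛ-emb (‵lift a) ‵spineTop = both (≤-spineTop (lift a)) (≤-trans (f≤y a) y≤t)
      gᵛ-emb (‵lift a) ‵toothTop = neither (lift-≰-toothTop a) (disjoint _ (f≤y a))
      gᵛ-emb ‵spineTop (‵lift b) = neither (spineTop-≰-lift b) (λ t≤f → t≰y (≤-trans t≤f (f≤y b)))
      gᵛ-emb ‵spineTop ‵spineTop = both (≤-spineTop spineTop) (≤-refl t)
      gᵛ-emb ‵spineTop ‵toothTop = neither (λ ()) t≰y′
      gᵛ-emb ‵toothTop (‵lift b) = neither (toothTop-≰-lift b) (λ y′≤f → disjoint y′ (≤-trans y′≤f (f≤y b)) (≤-refl y′))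
      gᵛ-emb ‵toothTop ‵spineTop = both (≤-spineTop toothTop) y′≤t
      gᵛ-emb ‵toothTop ‵toothTop = both refl (≤-refl y′)

module FinitePoset (P : Poset) (fin : Finite P) where
  open Poset P hiding (Carrier) renaming (refl to ≤-refl; trans to ≤-trans; antisym to ≤-antisym)
  open PosetProperties P
  private
    C = Carrier P
    xs = proj₁ fin
    xs∈ = proj₂ fin

  _≤?_ : Decidable _≤_
  a ≤? b = T? (a ≤ᵇ b)

  _≟_ : DecidableEquality C
  a ≟ b = map′ (λ (a≤b , b≤a) → ≤-antisym a≤b b≤a) (λ { refl → ≤-refl a , ≤-refl a }) ((a ≤? b) ×-dec (b ≤? a))

  _<?_ : Decidable _<_
  a <? b = (a ≤? b) ×-dec ¬? (a ≟ b)

  ≤⇒≡⊎< : ∀ {a b} → a ≤ b → a ≡ b ⊎ a < b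
  ≤⇒≡⊎< {a} {b} a≤b with a ≟ b
  ... | yes a≡b = inj₁ a≡b
  ... | no a≢b  = inj₂ (a≤b , a≢b)

  <-wellFounded : WellFounded _<_
  <-wellFounded = finite⇒wellFounded xs xs∈ <-isStrictPartialOrder

  >-wellFounded : WellFounded (flip _<_)
  >-wellFounded = finite⇒wellFounded xs xs∈ (Flip.isStrictPartialOrder <-isStrictPartialOrder)

  immPred⊎between : ∀ {c t} → c < t → ImmPred c t ⊎ ∃ λ u → c < u × u < t
  immPred⊎between {c} {t} c<t with any? (λ u → (c <? u) ×-dec (u <? t)) xs
  ... | yes between = inj₂ (Any.satisfied between)
  ... | no ¬between = inj₁ (c<t , cover)
    where
      cover : ∀ u → c ≤ u → u ≤ t → u ≡ c ⊎ u ≡ t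
      cover u c≤u u≤t with u ≟ c | u ≟ t
      ... | yes u≡c | _       = inj₁ u≡c
      ... | no _    | yes u≡t = inj₂ u≡t
      ... | no u≢c  | no u≢t  = ⊥-elim (¬between (lose (xs∈ u) ((c≤u , u≢c ∘ sym) , (u≤t , u≢t))))

  immPred⇒¬between : ∀ {c u t} → ImmPred c t → ¬ (c < u × u < t)
  immPred⇒¬between (_ , cover) ((c≤u , c≢u) , (u≤t , u≢t)) with cover _ c≤u u≤t
  ... | inj₁ u≡c = c≢u (sym u≡c)
  ... | inj₂ u≡t = u≢t u≡t

  immPred? : Decidable ImmPred
  immPred? c t with c <? t
  ... | no c≮t = no (c≮t ∘ proj₁)
  ... | yes c<t with immPred⊎between c<t
  ...   | inj₁ c⋖t             = yes c⋖t
  ...   | inj₂ (u , c<u , u<t) = no (λ c⋖t → immPred⇒¬between c⋖t (c<u , u<t))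

  <⇒≤immPred : ∀ {z t} → z < t → ∃ λ c → ImmPred c t × z ≤ c
  <⇒≤immPred {z} {t} = All.wfRec >-wellFounded _ Below-immPred step z
    where
      Below-immPred : C → Set
      Below-immPred z = z < t → ∃ λ c → ImmPred c t × z ≤ c

      step : ∀ z → WfRec (flip _<_) Below-immPred z → Below-immPred z
      step z above-z z<t with immPred⊎between z<t
      ... | inj₁ z⋖t             = z , z⋖t , ≤-refl z
      ... | inj₂ (u , z<u , u<t) with above-z z<u u<t
      ...   | c , c⋖t , u≤c        = c , c⋖t , ≤-trans (proj₁ z<u) u≤c

  immPreds : C → List C
  immPreds t = filter (λ c → immPred? c t) (deduplicate _≟_ xs)

  ∈-immPreds : ∀ {c t} → c ∈ immPreds t ⇔ ImmPred c t
  ∈-immPreds {c} {t} = mk⇔ (proj₂ ∘ ∈-filter⁻ (λ c → immPred? c t) {xs = deduplicate _≟_ xs})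
                           (∈-filter⁺ (λ c → immPred? c t) (∈-deduplicate⁺ _≟_ (xs∈ c)))

  immPreds-unique : ∀ t → Unique (immPreds t)
  immPreds-unique t = filter⁺ (λ c → immPred? c t) (deduplicate-! xs)
    where open import Data.List.Relation.Unary.Unique.DecPropositional.Properties _≟_ using (deduplicate-!; filter⁺)

  Down-finite : ∀ y → Finite (Down P y)
  Down-finite y = below xs , λ (z , z≤y) → ∈-below (xs∈ z) z≤y
    where
      below : List C → List (Carrier (Down P y))
      below []       = []
      below (z ∷ zs) with z ≤? y
      ... | yes z≤y = (z , z≤y) ∷ below zs
      ... | no _    = below zs

      ∈-below : ∀ {z zs} → z ∈ zs → (z≤y : z ≤ y) → (z , z≤y) ∈ below zs
      ∈-below {z} {zs = z′ ∷ zs} z∈ z≤y with z′ ≤? y | z∈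
      ... | yes z′≤y | here refl = here (cong (z ,_) (T-irrelevant z≤y z′≤y))
      ... | yes _    | there z∈zs = there (∈-below z∈zs z≤y)
      ... | no z′≰y  | here refl = ⊥-elim (z′≰y z≤y)
      ... | no _     | there z∈zs = ∈-below z∈zs z≤y

  record Trunk (t : C) : Set where
    field
      m          : ℕ
      x          : Fin (suc m) → C
      starts     : x zero ≡ t
      descending : ∀ i → x (suc i) < x (inject₁ i)
    end : C
    end = x (fromℕ m)
    field
      covers     : ∀ z → z ≤ t → (∃ λ i → z ≡ x i) ⊎ z < end
      branches   : ∀ c → ImmPred c end → ∃ λ d → ImmPred d end × d ≢ c

  trunk : ∀ t → Trunk t
  trunk = All.wfRec <-wellFounded _ Trunk step
    where
      step : ∀ t → WfRec _<_ Trunk t → Trunk t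
      step t trunk-below with singleton⊎siblings (λ c → ∈-immPreds {c} {t}) (immPreds-unique t)
      ... | inj₂ siblings = record
        { m = 0 ; x = λ _ → t ; starts = refl ; descending = λ ()
        ; covers = λ z z≤t → Sum.map₁ (zero ,_) (≤⇒≡⊎< z≤t) ; branches = siblings }
      ... | inj₁ (c , c⋖t , only-c) = record
        { m = suc m ; x = t Vector.∷ x ; starts = refl ; descending = descending′
        ; covers = covers′ ; branches = branches }
        where
          open Trunk (trunk-below (proj₁ c⋖t))
          descending′ : ∀ i → (t Vector.∷ x) (suc i) < (t Vector.∷ x) (inject₁ i)
          descending′ zero    = subst (_< t) (sym starts) (proj₁ c⋖t)
          descending′ (suc i) = descending i
          covers′ : ∀ z → z ≤ t → (∃ λ i → z ≡ (t Vector.∷ x) i) ⊎ z < end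
          covers′ z z≤t with ≤⇒≡⊎< z≤t
          ... | inj₁ z≡t = inj₁ (zero , z≡t)
          ... | inj₂ z<t with <⇒≤immPred z<t
          ...   | c′ , c′⋖t , z≤c′ =
            Sum.map₁ (λ (i , z≡xᵢ) → suc i , z≡xᵢ) (covers z (subst (z ≤_) (only-c c′ c′⋖t) z≤c′))

module CoTree (X : Poset) (ct : IsCoTree X) (fin : Finite X) where
  open Poset X hiding (Carrier) renaming (refl to ≤-refl; trans to ≤-trans; antisym to ≤-antisym)
  open PosetProperties X
  open FinitePoset X fin
  private
    C = Carrier X
    top = proj₁ (proj₁ ct)
    ≤-top = proj₂ (proj₁ ct)
    upset-chain = proj₂ ct

  Down-isCoTree : ∀ y → IsCoTree (Down X y)
  Down-isCoTree y = ((y , ≤-refl y) , proj₂) , λ z a b → upset-chain (proj₁ z) (proj₁ a) (proj₁ b)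

  immPred-disjoint : ∀ {a b t z} → ImmPred a t → ImmPred b t → z ≤ a → z ≤ b → a ≡ b
  immPred-disjoint a⋖t b⋖t z≤a z≤b with upset-chain _ _ _ z≤a z≤b
  ... | inj₁ a≤b = immPred-≤⇒≡ a⋖t b⋖t a≤b
  ... | inj₂ b≤a = sym (immPred-≤⇒≡ b⋖t a⋖t b≤a)

  record Decomposition (n : ℕ) : Set where
    field
      m K          : ℕ
      x            : Fin (suc m) → C
      y            : Fin K → C
      x₀-greatest  : ∀ z → z ≤ x zero
      x-descending : ∀ i → x (suc i) < x (inject₁ i)
      covering     : ∀ z → (∃ λ i → z ≡ x i) ⊎ (∃ λ j → z ≤ y j)
      y-disjoint   : ∀ j j′ z → z ≤ y j → z ≤ y j′ → j ≡ j′
      x≰y          : ∀ i j → ¬ x i ≤ y j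
      y-immPreds   : ∀ z → ImmPred z (x (fromℕ m)) ⇔ (∃ λ j → z ≡ y j)
      y-inT        : ∀ j → InT (suc n) (Down X (y j))

    x-comparable : ∀ i z → z ≤ x i ⊎ x i ≤ z
    x-comparable i z with covering z
    ... | inj₁ (i′ , refl) = upset-chain _ _ _ (last≤ i′) (last≤ i)
      where last≤ = descending⇒last≤ x x-descending
    ... | inj₂ (j , z≤yⱼ)  = inj₁ (≤-trans z≤yⱼ (≤-trans yⱼ≤last (descending⇒last≤ x x-descending i)))
      where yⱼ≤last = proj₁ (proj₁ (from (y-immPreds (y j)) (j , refl)))

  trunk⇒decomposition : Trunk top → ¬ CombEmbeds (suc (suc n)) X → Decomposition n
  trunk⇒decomposition {n} T no-comb = record
    { m = m ; K = length ys ; x = x ; y = lookup ys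
    ; x₀-greatest  = λ z → subst (z ≤_) (sym starts) (≤-top z)
    ; x-descending = descending
    ; covering     = covering
    ; y-disjoint   = λ j j′ z z≤yⱼ z≤yⱼ′ →
        lookup-injective (immPreds-unique end) (immPred-disjoint (y⋖end j) (y⋖end j′) z≤yⱼ z≤yⱼ′)
    ; x≰y          = λ i j xᵢ≤yⱼ → <⇒≱ (proj₁ (y⋖end j)) (≤-trans (descending⇒last≤ x descending i) xᵢ≤yⱼ)
    ; y-immPreds   = λ z → ⇔.trans (⇔.sym ∈-immPreds) ∈⇔∃lookup
    ; y-inT        = λ j → Down-isCoTree (lookup ys j) , Down-finite (lookup ys j) , no-comb ∘ extend j
    }
    where
      open Trunk T
      ys = immPreds end

      y⋖end : ∀ j → ImmPred (lookup ys j) end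
      y⋖end j = to ∈-immPreds (∈-lookup j)

      covering : ∀ z → (∃ λ i → z ≡ x i) ⊎ (∃ λ j → z ≤ lookup ys j)
      covering z with covers z (≤-top z)
      ... | inj₁ z≡xᵢ = inj₁ z≡xᵢ
      ... | inj₂ z<end with <⇒≤immPred z<end
      ...   | c , c⋖end , z≤c with to ∈⇔∃lookup (from ∈-immPreds c⋖end)
      ...     | j , c≡yⱼ = inj₂ (j , subst (z ≤_) c≡yⱼ z≤c)

      extend : ∀ j → CombEmbeds (suc n) (Down X (lookup ys j)) → CombEmbeds (suc (suc n)) X
      extend j with branches (lookup ys j) (y⋖end j)
      ... | y′ , y′⋖end , y′≢yⱼ = extend-comb (proj₁ (proj₁ (y⋖end j))) (proj₁ (proj₁ y′⋖end))
              (λ z z≤yⱼ z≤y′ → y′≢yⱼ (immPred-disjoint y′⋖end (y⋖end j) z≤y′ z≤yⱼ))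

  -- Kept separate from trunk⇒decomposition: with-abstraction over the concrete
  -- trunk top makes Agda unfold the well-founded recursion that builds it.
  no-comb⇒decomposition : ¬ CombEmbeds (suc (suc n)) X → Decomposition n
  no-comb⇒decomposition = trunk⇒decomposition (trunk top)

  decomposition⇒no-comb : Decomposition n → ¬ CombEmbeds (suc (suc n)) X
  decomposition⇒no-comb {n} d (f , f-emb) = [ w-on-trunk , w-in-branch ]′ (covering (f w))
    where
      open Decomposition d
      w v : Comb (suc (suc n))
      w = lift spineTop
      v = toothTop

      w≰v : ¬ f w ≤ f v
      w≰v = lift-≰-toothTop (spineTop {n}) ∘ from (f-emb w v)

      v≰w : ¬ f v ≤ f w
      v≰w = toothTop-≰-lift (spineTop {n}) ∘ from (f-emb v w)

      w-on-trunk : ¬ ∃ λ i → f w ≡ x i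
      w-on-trunk (i , fw≡xᵢ) =
        [ v≰w ∘ subst (f v ≤_) (sym fw≡xᵢ) , w≰v ∘ subst (_≤ f v) (sym fw≡xᵢ) ]′ (x-comparable i (f v))

      w-in-branch : ¬ ∃ λ j → f w ≤ y j
      w-in-branch (j , fw≤yⱼ) = proj₂ (proj₂ (y-inT j)) (comb-below (restrict-comb (f , f-emb)) fw≤yⱼ)

lemma4p7 : (X : Poset) → IsCoTree X → Finite X → (n : ℕ) →
    InT (suc (suc n)) X ⇔
      (Σ ℕ λ m → Σ ℕ λ K → Σ (Fin (suc m) → Carrier X) λ x → Σ (Fin K → Carrier X) λ y →
        (∀ z → Poset._≤_ X z (x zero))
        × (∀ (i : Fin m) → Poset._<_ X (x (suc i)) (x (inject₁ i)))
        × (∀ z → (∃ λ i → z ≡ x i) ⊎ (∃ λ j → Poset._≤_ X z (y j)))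
        × (∀ j j′ z → Poset._≤_ X z (y j) → Poset._≤_ X z (y j′) → j ≡ j′)
        × (∀ i j → ¬ Poset._≤_ X (x i) (y j))
        × (∀ z → Poset.ImmPred X z (x (fromℕ m)) ⇔ (∃ λ j → z ≡ y j))
        × (∀ j → InT (suc n) (Down X (y j))))
lemma4p7 X ct fin n = mk⇔
  (λ (_ , _ , no-comb) → let open Decomposition (no-comb⇒decomposition no-comb) in
    m , K , x , y , x₀-greatest , x-descending , covering , y-disjoint , x≰y , y-immPreds , y-inT)
  (λ (m , K , x , y , x₀-greatest , x-descending , covering , y-disjoint , x≰y , y-immPreds , y-inT) →
    ct , fin , decomposition⇒no-comb (record
      { m = m ; K = K ; x = x ; y = y ; x₀-greatest = x₀-greatest ; x-descending = x-descending
      ; covering = covering ; y-disjoint = y-disjoint ; x≰y = x≰y ; y-immPreds = y-immPreds ; y-inT = y-inT }))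
  where open CoTree X ct fin
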